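{- For all $m, k \in \mathbb{N}$ with $m \ge k$ and both $m$ and $k$ even, $$\binom{m}{k} \le \left(\frac{m}{2} + 1\right)^2 \binom{m/2}{k/2}^2 .$$ -}

module Defs where

{-# OPTIONS --safe #-}
module Submission where

-- Write m = 2n, k = 2j and b = n - j.  The multinomial coefficient (2n; j, j, b, b),
-- computed by first splitting 2n into blocks 2j | 2b or into blocks n | n, gives
-- C(2n,2j) C(2j,j) C(2b,b) = C(2n,n) C(n,j)^2.  The recurrence
-- (n+1) C(2n+2,n+1) = 2(2n+1) C(2n,n) yields 4^n ≤ (n+1) C(2n,n) and C(2n,n) ≤ 4^n, so
-- C(2n,n) ≤ 4^j 4^b ≤ (n+1)^2 C(2j,j) C(2b,b); dividing the identity by C(2j,j) C(2b,b)
-- gives the bound.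

open import Defs
open import Data.Nat using (ℕ; _+_; _*_; _^_; _≤_; _≥_; _/_)
open import Data.Nat.Divisibility using (_∣_)
open import Data.Nat.Combinatorics using (_C_)

open import Data.Nat using (zero; suc; s≤s; _!; _∸_; NonZero)
open import Data.Nat.Combinatorics using (nCk≡n!/k![n-k]!; k![n∸k]!∣n!)
open import Data.Nat.Divisibility using (divides)
open import Data.Nat.DivMod using (m/n*n≡m; m*n/n≡m)
open import Data.Nat.Properties
open import Data.Nat.Tactic.RingSolver using (solve-∀)
open import Data.Product using (_,_)
open import Relation.Binary.PropositionalEquality

open import Algebra.Properties.CommutativeSemigroup +-commutativeSemigroup
  using () renaming (interchange to +-interchange)
open import Algebra.Properties.CommutativeSemigroup *-commutativeSemigroup
  using (x∙yz≈yx∙z; x∙yz≈y∙xz) renaming (interchange to *-interchange)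

nCk*k!*[n∸k]!≡n! : ∀ {n k} → k ≤ n → (n C k) * (k ! * (n ∸ k) !) ≡ n !
nCk*k!*[n∸k]!≡n! {n} {k} k≤n = begin
  (n C k) * (k ! * (n ∸ k) !)                   ≡⟨ cong (_* (k ! * (n ∸ k) !)) (nCk≡n!/k![n-k]! k≤n) ⟩
  (n ! / (k ! * (n ∸ k) !)) * (k ! * (n ∸ k) !) ≡⟨ m/n*n≡m (k![n∸k]!∣n! k≤n) ⟩
  n !                                           ∎
  where open ≡-Reasoning; instance _ = k !* (n ∸ k) !≢0

[m+n]Cm*m!*n!≡[m+n]! : ∀ m n → ((m + n) C m) * (m ! * n !) ≡ (m + n) !
[m+n]Cm*m!*n!≡[m+n]! m n =
  subst (λ o → ((m + n) C m) * (m ! * o !) ≡ (m + n) !) (m+n∸m≡n m n)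
        (nCk*k!*[n∸k]!≡n! (m≤m+n m n))

nCk≢0 : ∀ {n k} → k ≤ n → NonZero (n C k)
nCk≢0 {n} {k} k≤n =
  m*n≢0⇒m≢0 (n C k) {{subst NonZero (sym (nCk*k!*[n∸k]!≡n! k≤n)) (n !≢0)}}

multinomial : ℕ → ℕ → ℕ → ℕ → ℕ
multinomial a b c d = ((a + b + (c + d)) C (a + b)) * (((a + b) C a) * ((c + d) C c))

multinomial*factorials≡! : ∀ a b c d →
  multinomial a b c d * ((a ! * b !) * (c ! * d !)) ≡ (a + b + (c + d)) !
multinomial*factorials≡! a b c d = begin
  N * (A * B) * ((a ! * b !) * (c ! * d !))   ≡⟨ *-assoc N (A * B) _ ⟩
  N * ((A * B) * ((a ! * b !) * (c ! * d !))) ≡⟨ cong (N *_) (*-interchange A B _ _) ⟩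
  N * ((A * (a ! * b !)) * (B * (c ! * d !)))
    ≡⟨ cong (N *_) (cong₂ _*_ ([m+n]Cm*m!*n!≡[m+n]! a b) ([m+n]Cm*m!*n!≡[m+n]! c d)) ⟩
  N * ((a + b) ! * (c + d) !)                 ≡⟨ [m+n]Cm*m!*n!≡[m+n]! (a + b) (c + d) ⟩
  (a + b + (c + d)) !                         ∎
  where
  open ≡-Reasoning
  N = (a + b + (c + d)) C (a + b)
  A = (a + b) C a
  B = (c + d) C c

multinomial-swap : ∀ a b c d → multinomial a b c d ≡ multinomial a c b d
multinomial-swap a b c d =
  *-cancelʳ-≡ _ _ (a ! * b ! * (c ! * d !)) {{m*n≢0 _ _ {{a !* b !≢0}} {{c !* d !≢0}}}} (begin
  multinomial a b c d * ((a ! * b !) * (c ! * d !)) ≡⟨ multinomial*factorials≡! a b c d ⟩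
  (a + b + (c + d)) !                               ≡⟨ cong _! (+-interchange a b c d) ⟩
  (a + c + (b + d)) !                               ≡⟨ multinomial*factorials≡! a c b d ⟨
  multinomial a c b d * ((a ! * c !) * (b ! * d !))
    ≡⟨ cong (multinomial a c b d *_) (*-interchange (a !) (c !) (b !) (d !)) ⟩
  multinomial a c b d * ((a ! * b !) * (c ! * d !)) ∎)
  where open ≡-Reasoning

centralBinomial : ℕ → ℕ
centralBinomial n = (n + n) C n

centralBinomial≢0 : ∀ n → NonZero (centralBinomial n)
centralBinomial≢0 n = nCk≢0 (m≤m+n n n)

centralBinomial-suc : ∀ n →
  suc n * centralBinomial (suc n) ≡ 2 * suc (n + n) * centralBinomial n
centralBinomial-suc n =
  *-cancelʳ-≡ _ _ (suc n * (n ! * n !)) {{m*n≢0 (suc n) _ {{_}} {{n !* n !≢0}}}} (begin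
  suc n * c′ * (suc n * (n ! * n !))                    ≡⟨ regroupˡ (suc n) c′ (n !) ⟩
  c′ * (suc n ! * suc n !)                              ≡⟨ [m+n]Cm*m!*n!≡[m+n]! (suc n) (suc n) ⟩
  (suc n + suc n) !                                     ≡⟨ cong (λ o → suc o !) (+-suc n n) ⟩
  suc (suc (n + n)) * (suc (n + n) * (n + n) !)         ≡⟨ cong (λ o → suc (suc (n + n)) * (suc (n + n) * o))
                                                                ([m+n]Cm*m!*n!≡[m+n]! n n) ⟨
  suc (suc (n + n)) * (suc (n + n) * (c * (n ! * n !))) ≡⟨ regroupʳ n c (n ! * n !) ⟩
  2 * suc (n + n) * c * (suc n * (n ! * n !))           ∎)
  where
  open ≡-Reasoning
  c = centralBinomial n
  c′ = centralBinomial (suc n)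
  regroupˡ : ∀ s x f → s * x * (s * (f * f)) ≡ x * ((s * f) * (s * f))
  regroupˡ = solve-∀
  regroupʳ : ∀ n x y → suc (suc (n + n)) * (suc (n + n) * (x * y)) ≡ 2 * suc (n + n) * x * (suc n * y)
  regroupʳ = solve-∀

centralBinomial≤4^n : ∀ n → centralBinomial n ≤ 4 ^ n
centralBinomial≤4^n zero    = ≤-refl
centralBinomial≤4^n (suc n) =
  *-cancelˡ-≤ {centralBinomial (suc n)} {4 ^ suc n} (suc n) (begin
  suc n * centralBinomial (suc n)     ≡⟨ centralBinomial-suc n ⟩
  2 * suc (n + n) * c                 ≤⟨ *-monoˡ-≤ c (*-monoʳ-≤ 2 (n≤1+n (suc (n + n)))) ⟩
  2 * suc (suc (n + n)) * c           ≤⟨ *-monoʳ-≤ (2 * suc (suc (n + n))) (centralBinomial≤4^n n) ⟩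
  2 * suc (suc (n + n)) * 4 ^ n       ≡⟨ regroup n (4 ^ n) ⟩
  suc n * 4 ^ suc n                   ∎)
  where
  open ≤-Reasoning
  c = centralBinomial n
  regroup : ∀ n x → 2 * suc (suc (n + n)) * x ≡ suc n * (4 * x)
  regroup = solve-∀

4^n≤[1+n]*centralBinomial : ∀ n → 4 ^ n ≤ suc n * centralBinomial n
4^n≤[1+n]*centralBinomial zero    = ≤-refl
4^n≤[1+n]*centralBinomial (suc n) =
  *-cancelˡ-≤ {4 ^ suc n} {suc (suc n) * centralBinomial (suc n)} (suc n) (begin
  suc n * 4 ^ suc n                   ≡⟨ x∙yz≈yx∙z (suc n) 4 (4 ^ n) ⟩
  4 * suc n * 4 ^ n                   ≤⟨ *-monoʳ-≤ (4 * suc n) (4^n≤[1+n]*centralBinomial n) ⟩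
  4 * suc n * (suc n * c)             ≤⟨ m≤m+n _ (2 * n * c) ⟩
  4 * suc n * (suc n * c) + 2 * n * c ≡⟨ expand n c ⟩
  suc (suc n) * (2 * suc (n + n) * c) ≡⟨ cong (suc (suc n) *_) (centralBinomial-suc n) ⟨
  suc (suc n) * (suc n * c′)          ≡⟨ x∙yz≈y∙xz (suc (suc n)) (suc n) c′ ⟩
  suc n * (suc (suc n) * c′)          ∎)
  where
  open ≤-Reasoning
  c = centralBinomial n
  c′ = centralBinomial (suc n)
  expand : ∀ n c → 4 * suc n * (suc n * c) + 2 * n * c ≡ suc (suc n) * (2 * suc (n + n) * c)
  expand = solve-∀

centralBinomial-+-≤ : ∀ m n →
  centralBinomial (m + n) ≤ suc (m + n) * suc (m + n) * (centralBinomial m * centralBinomial n)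
centralBinomial-+-≤ m n = begin
  centralBinomial (m + n)          ≤⟨ centralBinomial≤4^n (m + n) ⟩
  4 ^ (m + n)                      ≡⟨ ^-distribˡ-+-* 4 m n ⟩
  4 ^ m * 4 ^ n                    ≤⟨ *-mono-≤ (4^n≤[1+n]*centralBinomial m) (4^n≤[1+n]*centralBinomial n) ⟩
  (suc m * cm) * (suc n * cn)      ≡⟨ *-interchange (suc m) cm (suc n) cn ⟩
  (suc m * suc n) * (cm * cn)      ≤⟨ *-monoˡ-≤ (cm * cn) (*-mono-≤ (s≤s (m≤m+n m n)) (s≤s (m≤n+m n m))) ⟩
  suc (m + n) * suc (m + n) * (cm * cn) ∎
  where
  open ≤-Reasoning
  cm = centralBinomial m
  cn = centralBinomial n

[n+n]C[j+j]≤[n+1]²*[nCj]² : ∀ {n j} → j ≤ n → (n + n) C (j + j) ≤ (n + 1) ^ 2 * (n C j) ^ 2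
[n+n]C[j+j]≤[n+1]²*[nCj]² {n} {j} j≤n with m≤n⇒∃[o]m+o≡n j≤n
... | b , refl =
  *-cancelʳ-≤ _ _ (cj * cb) {{m*n≢0 cj cb {{centralBinomial≢0 j}} {{centralBinomial≢0 b}}}} (begin
  ((n + n) C (j + j)) * (cj * cb) ≡⟨ cong (λ t → (t C (j + j)) * (cj * cb)) (+-interchange j b j b) ⟩
  multinomial j j b b             ≡⟨ multinomial-swap j j b b ⟩
  centralBinomial n * (B * B)     ≤⟨ *-monoˡ-≤ (B * B) (centralBinomial-+-≤ j b) ⟩
  suc n * suc n * (cj * cb) * (B * B) ≡⟨ regroup n (cj * cb) B ⟩
  (n + 1) ^ 2 * B ^ 2 * (cj * cb) ∎)
  where
  open ≤-Reasoning
  cj = centralBinomial j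
  cb = centralBinomial b
  B = n C j
  -- The squares are written unfolded because the solver does not accept _^_ here.
  regroup : ∀ n x y → suc n * suc n * x * (y * y) ≡ (n + 1) * ((n + 1) * 1) * (y * (y * 1)) * x
  regroup = solve-∀

n*2≡n+n : ∀ n → n * 2 ≡ n + n
n*2≡n+n = solve-∀

mainTheorem2 : (m k : ℕ) → m ≥ k → 2 ∣ m → 2 ∣ k →
    m C k ≤ (m / 2 + 1) ^ 2 * ((m / 2) C (k / 2)) ^ 2
mainTheorem2 _ _ k≤m (divides n refl) (divides j refl) = begin
  (n * 2) C (j * 2)         ≡⟨ cong₂ _C_ (n*2≡n+n n) (n*2≡n+n j) ⟩
  (n + n) C (j + j)         ≤⟨ [n+n]C[j+j]≤[n+1]²*[nCj]² (*-cancelʳ-≤ j n 2 k≤m) ⟩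
  (n + 1) ^ 2 * (n C j) ^ 2 ≡⟨ cong₂ (λ n j → (n + 1) ^ 2 * (n C j) ^ 2) (m*n/n≡m n 2) (m*n/n≡m j 2) ⟨
  (n * 2 / 2 + 1) ^ 2 * ((n * 2 / 2) C (j * 2 / 2)) ^ 2 ∎
  where open ≤-Reasoning
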